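{- Let $n\geq 3$ be an integer and let $(d_1^1,\ldots,d_n^1)$ and $(d_1^2,\ldots,d_n^2)$ be two graphic sequences (each weakly decreasing) with $d_n^1\geq 1$ and $d_n^2\geq 1$. If $d_1^1 d_1^2 < \frac{n}{2}$, then $(d_1^1,\ldots,d_n^1)$ and $(d_1^2,\ldots,d_n^2)$ pack.
   Context: A weakly decreasing sequence $(d_1,\ldots,d_n)$ of non-negative integers is graphic if there is a simple graph $G$ with $V(G)=[n]$ and $\deg_G(i)=d_i$ for all $i\in[n]$. Two graphic sequences $(d_1^1,\ldots,d_n^1)$ and $(d_1^2,\ldots,d_n^2)$ pack if there are edge-disjoint simple graphs $G_1,G_2$ on the same vertex set $[n]$ with $\deg_{G_j}(i)=d_i^j$ for all $i\in[n]$ and $j\in\{1,2\}$. -}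

module Defs where

open import Data.Nat using (ℕ; zero; suc; _+_; _*_; _≤_; _<_)
open import Data.Bool using (Bool; true; false)
open import Data.Fin using (Fin)
import Data.Fin as F
open import Data.Vec.Functional using (Vector)
open import Data.List using (List; filter; length; allFin)
open import Data.Product using (Σ; _×_; _,_)
open import Relation.Binary.PropositionalEquality using (_≡_)
open import Relation.Nullary using (¬_)

record SimpleGraph (n : ℕ) : Set where
  field
    adj   : Fin n → Fin n → Bool
    sym   : ∀ i j → adj i j ≡ adj j i
    irrefl : ∀ i → adj i i ≡ false
open SimpleGraph public

countTrue : ∀ {n} → (Fin n → Bool) → ℕ
countTrue {zero} f = 0
countTrue {suc n} f with f F.zero
... | true  = suc (countTrue (λ i → f (F.suc i)))
... | false = countTrue (λ i → f (F.suc i))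

deg : ∀ {n} → SimpleGraph n → Fin n → ℕ
deg G i = countTrue (adj G i)

Realizes : ∀ {n} → SimpleGraph n → Vector ℕ n → Set
Realizes G d = ∀ i → deg G i ≡ d i

WeaklyDecreasing : ∀ {n} → Vector ℕ n → Set
WeaklyDecreasing d = ∀ i j → i F.≤ j → d j ≤ d i

Graphic : ∀ {n} → Vector ℕ n → Set
Graphic {n} d = WeaklyDecreasing d × Σ (SimpleGraph n) (λ G → Realizes G d)

EdgeDisjoint : ∀ {n} → SimpleGraph n → SimpleGraph n → Set
EdgeDisjoint G H = ∀ i j → ¬ (adj G i j ≡ true × adj H i j ≡ true)

Pack : ∀ {n} → Vector ℕ n → Vector ℕ n → Set
Pack {n} d₁ d₂ = Σ (SimpleGraph n) λ G₁ → Σ (SimpleGraph n) λ G₂ →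
  EdgeDisjoint G₁ G₂ × Realizes G₁ d₁ × Realizes G₂ d₂

-- Remove the common edges one at a time by 2-switches in G, the graph with the smaller maximum
-- degree a ≤ b. If uv is an edge of both G and H, pick an edge xy of G with x outside N[u] and
-- y outside N[v], where N[w] is the closed neighbourhood of w in G ∪ H; replacing uv, xy by ux, vy
-- preserves every degree of G and destroys a common edge without creating one. Such an xy exists:
-- otherwise each vertex outside N[u] ∪ N[v], having positive degree, has a G-neighbour in
-- N[u] ∩ N[v] ∖ {u, v}, and as |N[u]|, |N[v]| ≤ a + b, counting vertices gives n ≤ 2ab.
module Submission where

open import Defs hiding (sym)
open import Data.Bool using (Bool; true; false; _∧_; _∨_; not; if_then_else_)
  renaming (_≟_ to _≟ᵇ_)
open import Data.Bool.Properties
  using ( ∨-comm; ∧-comm; ∨-identityʳ; ∧-identityʳ; ∧-zeroʳ; ∨-conicalˡ; ∨-conicalʳ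
        ; ∧-conicalˡ; ∧-conicalʳ; not-involutive; ¬-not)
open import Data.Empty using (⊥)
open import Data.Fin using (Fin; zero; suc; fromℕ)
open import Data.Fin.Properties using (_≟_; any?; ≤fromℕ; suc-injective)
open import Data.Nat using (ℕ; zero; suc; _+_; _*_; _≤_; _<_; z≤n; s≤s; s≤s⁻¹; _≤?_; +-0-rawMonoid)
open import Data.Nat.Properties hiding (_≟_; suc-injective)
import Data.Nat.Properties as ℕ
open import Data.Nat.Tactic.RingSolver using (solve-∀)
open import Algebra.Definitions.RawMonoid +-0-rawMonoid using (sum)
open import Data.Product using (∃; ∃₂; _×_; _,_; proj₁; proj₂)
import Data.Product as Product
open import Data.Sum using (_⊎_; inj₁; inj₂)
open import Data.Vec.Functional using (Vector)
open import Function using (_∘_; _$_; id; case_of_)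
open import Relation.Nullary using (Dec; yes; no; does; contradiction; _×-dec_)
open import Relation.Nullary.Decidable using (dec-true; dec-false)
open import Relation.Binary.PropositionalEquality
  using (_≡_; _≢_; refl; sym; trans; cong; cong₂; subst; module ≡-Reasoning)

_==_ : ∀ {n} → Fin n → Fin n → Bool
i == j = does (i ≟ j)

==-refl : ∀ {n} (i : Fin n) → (i == i) ≡ true
==-refl i = dec-true (i ≟ i) refl

==-≢ : ∀ {n} {i j : Fin n} → i ≢ j → (i == j) ≡ false
==-≢ {i = i} {j} = dec-false (i ≟ j)

==⇒≡ : ∀ {n} {i j : Fin n} → (i == j) ≡ true → i ≡ j
==⇒≡ {i = i} {j} e with i ≟ j
... | yes i≡j = i≡j
... | no _ = contradiction e λ ()


countTrue-cong : ∀ {n} {f g : Fin n → Bool} → (∀ i → f i ≡ g i) → countTrue f ≡ countTrue g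
countTrue-cong {zero} f≗g = refl
countTrue-cong {suc n} {f} {g} f≗g with f zero | g zero | f≗g zero
... | true  | .true  | refl = cong suc (countTrue-cong (λ i → f≗g (suc i)))
... | false | .false | refl = countTrue-cong (λ i → f≗g (suc i))

countTrue-none : ∀ {n} {f : Fin n → Bool} → (∀ i → f i ≡ false) → countTrue f ≡ 0
countTrue-none {zero} _ = refl
countTrue-none {suc n} {f} f≡false with f zero | f≡false zero
... | false | refl = countTrue-none (λ i → f≡false (suc i))

countTrue-pos : ∀ {n} {f : Fin n → Bool} i → f i ≡ true → 1 ≤ countTrue f
countTrue-pos {suc n} {f} i fi with f zero in f0
countTrue-pos zero    fi | true  = s≤s z≤n
countTrue-pos (suc i) fi | true  = s≤s z≤n
countTrue-pos zero    fi | false = contradiction (trans (sym f0) fi) λ ()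
countTrue-pos (suc i) fi | false = countTrue-pos i fi

countTrue-witness : ∀ {n} (f : Fin n → Bool) → 1 ≤ countTrue f → ∃ λ i → f i ≡ true
countTrue-witness {suc n} f pos with f zero in f0
... | true  = zero , f0
... | false = Product.map suc id (countTrue-witness (λ i → f (suc i)) pos)

countTrue-mono : ∀ {n} {f g : Fin n → Bool} → (∀ i → f i ≡ true → g i ≡ true) →
                 countTrue f ≤ countTrue g
countTrue-mono {zero} _ = z≤n
countTrue-mono {suc n} {f} {g} f⊆g with f zero in f0 | g zero in g0
... | true  | true  = s≤s (countTrue-mono (λ i → f⊆g (suc i)))
... | false | true  = m≤n⇒m≤1+n (countTrue-mono (λ i → f⊆g (suc i)))
... | false | false = countTrue-mono (λ i → f⊆g (suc i))
... | true  | false = contradiction (trans (sym (f⊆g zero f0)) g0) λ ()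

countTrue-mono-< : ∀ {n} {f g : Fin n → Bool} → (∀ i → f i ≡ true → g i ≡ true) →
                   ∀ i → f i ≡ false → g i ≡ true → countTrue f < countTrue g
countTrue-mono-< {suc n} {f} {g} f⊆g i fi gi with f zero in f0 | g zero in g0
countTrue-mono-< f⊆g zero    fi gi | false | true  = s≤s (countTrue-mono (λ i → f⊆g (suc i)))
countTrue-mono-< f⊆g zero    fi gi | true  | _     = contradiction (trans (sym f0) fi) λ ()
countTrue-mono-< f⊆g zero    fi gi | false | false = contradiction (trans (sym g0) gi) λ ()
countTrue-mono-< f⊆g (suc i) fi gi | true  | true  = s≤s (countTrue-mono-< (λ i → f⊆g (suc i)) i fi gi)
countTrue-mono-< f⊆g (suc i) fi gi | false | true  = m≤n⇒m≤1+n (countTrue-mono-< (λ i → f⊆g (suc i)) i fi gi)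
countTrue-mono-< f⊆g (suc i) fi gi | false | false = countTrue-mono-< (λ i → f⊆g (suc i)) i fi gi
countTrue-mono-< f⊆g (suc i) fi gi | true  | false = contradiction (trans (sym (f⊆g zero f0)) g0) λ ()

countTrue-∨-∧ : ∀ {n} (f g : Fin n → Bool) →
  countTrue (λ i → f i ∨ g i) + countTrue (λ i → f i ∧ g i) ≡ countTrue f + countTrue g
countTrue-∨-∧ {zero} f g = refl
countTrue-∨-∧ {suc n} f g with f zero | g zero
... | true  | true  = cong suc (begin
  U + suc I   ≡⟨ +-suc U I ⟩
  suc (U + I) ≡⟨ cong suc (countTrue-∨-∧ f′ g′) ⟩
  suc (F + G) ≡⟨ +-suc F G ⟨
  F + suc G   ∎)
  where
  open ≡-Reasoning
  f′ g′ : Fin n → Bool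
  f′ i = f (suc i)
  g′ i = g (suc i)
  U = countTrue (λ i → f′ i ∨ g′ i)
  I = countTrue (λ i → f′ i ∧ g′ i)
  F = countTrue f′
  G = countTrue g′
... | true  | false = cong suc (countTrue-∨-∧ (λ i → f (suc i)) (λ i → g (suc i)))
... | false | true  = trans (cong suc (countTrue-∨-∧ (λ i → f (suc i)) (λ i → g (suc i))))
                            (sym (+-suc _ _))
... | false | false = countTrue-∨-∧ (λ i → f (suc i)) (λ i → g (suc i))

countTrue-∨ : ∀ {n} (f g : Fin n → Bool) → countTrue (λ i → f i ∨ g i) ≤ countTrue f + countTrue g
countTrue-∨ f g = ≤-trans (m≤m+n _ _) (≤-reflexive (countTrue-∨-∧ f g))

countTrue-not : ∀ {n} (f : Fin n → Bool) → countTrue f + countTrue (λ i → not (f i)) ≡ n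
countTrue-not {zero} f = refl
countTrue-not {suc n} f with f zero
... | true  = cong suc (countTrue-not _)
... | false = trans (+-suc _ _) (cong suc (countTrue-not _))

countTrue-raise : ∀ {n} {f g : Fin n → Bool} i → f i ≡ false → g i ≡ true →
                  (∀ j → j ≢ i → f j ≡ g j) → countTrue g ≡ suc (countTrue f)
countTrue-raise {suc n} {f} {g} zero fi gi f≗g with f zero | g zero
... | false | true = cong suc (countTrue-cong (λ j → sym (f≗g (suc j) (λ ()))))
countTrue-raise {suc n} {f} {g} (suc i) fi gi f≗g with f zero | g zero | f≗g zero (λ ())
... | true  | .true  | refl = cong suc (countTrue-raise i fi gi (λ j j≢i → f≗g (suc j) (j≢i ∘ suc-injective)))
... | false | .false | refl = countTrue-raise i fi gi (λ j j≢i → f≗g (suc j) (j≢i ∘ suc-injective))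

countTrue-insert : ∀ {n} (f : Fin n → Bool) {i} → f i ≡ false →
                   countTrue (λ j → if j == i then true else f j) ≡ suc (countTrue f)
countTrue-insert f {i} fi = countTrue-raise i fi (cong (if_then true else f i) (==-refl i))
  (λ j j≢i → cong (if_then true else f j) (sym (==-≢ j≢i)))

countTrue-delete : ∀ {n} (f : Fin n → Bool) {i} → f i ≡ true →
                   countTrue f ≡ suc (countTrue (λ j → if j == i then false else f j))
countTrue-delete f {i} fi = countTrue-raise i (cong (if_then false else f i) (==-refl i)) fi
  (λ j j≢i → cong (if_then false else f j) (==-≢ j≢i))

countTrue-move : ∀ {n} (f : Fin n → Bool) {i j} → f i ≡ true → f j ≡ false → i ≢ j →
  countTrue (λ k → if k == i then false else if k == j then true else f k) ≡ countTrue f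
countTrue-move f {i} {j} fi fj i≢j = ℕ.suc-injective (begin
  suc (countTrue (λ k → if k == i then false else g k)) ≡⟨ countTrue-delete g gi ⟨
  countTrue g                                          ≡⟨ countTrue-insert f fj ⟩
  suc (countTrue f)                                    ∎)
  where
  open ≡-Reasoning
  g : Fin _ → Bool
  g k = if k == j then true else f k
  gi : g i ≡ true
  gi = trans (cong (if_then true else f i) (==-≢ i≢j)) fi

countTrue-cover : ∀ {m n a} (P : Fin n → Bool) (Q : Fin m → Bool) (E : Fin m → Fin n → Bool) →
  (∀ y → countTrue (E y) ≤ a) → (∀ x → P x ≡ true → ∃ λ y → Q y ≡ true × E y x ≡ true) →
  countTrue P ≤ countTrue Q * a
countTrue-cover {zero} P Q E _ cover =
  ≤-reflexive (countTrue-none λ x → ¬-not {y = true} λ Px → case cover x Px of λ ())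
countTrue-cover {suc m} {a = a} P Q E E≤a cover with Q zero in Q0
... | false = countTrue-cover P Q′ E′ (E≤a ∘ suc) cover′
  where
  Q′ = λ y → Q (suc y)
  E′ = λ y → E (suc y)
  cover′ : ∀ x → P x ≡ true → ∃ λ y → Q′ y ≡ true × E′ y x ≡ true
  cover′ x Px with cover x Px
  ... | zero  , Qy , _   = contradiction (trans (sym Q0) Qy) λ ()
  ... | suc y , Qy , Eyx = y , Qy , Eyx
... | true = begin
  countTrue P                               ≤⟨ countTrue-mono P⊆ ⟩
  countTrue (λ x → E zero x ∨ P′ x)         ≤⟨ countTrue-∨ (E zero) P′ ⟩
  countTrue (E zero) + countTrue P′         ≤⟨ +-mono-≤ (E≤a zero) (countTrue-cover P′ Q′ E′ (E≤a ∘ suc) cover′) ⟩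
  a + countTrue Q′ * a                      ∎
  where
  open ≤-Reasoning
  Q′ = λ y → Q (suc y)
  E′ = λ y → E (suc y)
  P′ : Fin _ → Bool
  P′ x = P x ∧ not (E zero x)
  P⊆ : ∀ x → P x ≡ true → E zero x ∨ P′ x ≡ true
  P⊆ x Px with E zero x
  ... | true  = refl
  ... | false = trans (∧-identityʳ (P x)) Px
  cover′ : ∀ x → P′ x ≡ true → ∃ λ y → Q′ y ≡ true × E′ y x ≡ true
  cover′ x P′x with cover x (∧-conicalˡ _ _ P′x)
  ... | zero  , _  , E0x = contradiction (subst (λ b → not b ≡ true) E0x (∧-conicalʳ _ _ P′x)) λ ()
  ... | suc y , Qy , Eyx = y , Qy , Eyx

sum-mono-≤ : ∀ {n} {f g : Fin n → ℕ} → (∀ i → f i ≤ g i) → sum f ≤ sum g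
sum-mono-≤ {zero}  _   = z≤n
sum-mono-≤ {suc n} f≤g = +-mono-≤ (f≤g zero) (sum-mono-≤ (f≤g ∘ suc))

sum-mono-< : ∀ {n} {f g : Fin n → ℕ} → (∀ i → f i ≤ g i) → ∀ i → f i < g i → sum f < sum g
sum-mono-< {suc n} f≤g zero    f<g = +-mono-<-≤ f<g (sum-mono-≤ (f≤g ∘ suc))
sum-mono-< {suc n} f≤g (suc i) f<g = +-mono-≤-< (f≤g zero) (sum-mono-< (f≤g ∘ suc) i f<g)

-- Ordered pairs, so every edge of a symmetric relation is counted twice.
pairCount : ∀ {n} → (Fin n → Fin n → Bool) → ℕ
pairCount E = sum (λ p → countTrue (E p))

pairCount-mono-< : ∀ {n} {E F : Fin n → Fin n → Bool} → (∀ p q → E p q ≡ true → F p q ≡ true) →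
                   ∀ p q → E p q ≡ false → F p q ≡ true → pairCount E < pairCount F
pairCount-mono-< E⊆F p q Epq Fpq =
  sum-mono-< (λ r → countTrue-mono (E⊆F r)) p (countTrue-mono-< (E⊆F p) q Epq Fpq)

edge : ∀ {n} → Fin n → Fin n → Fin n → Fin n → Bool
edge a b p q = (p == a ∧ q == b) ∨ (p == b ∧ q == a)

module _ {n} (a b : Fin n) where

  edge-comm : ∀ p q → edge a b p q ≡ edge b a p q
  edge-comm p q = ∨-comm (p == a ∧ q == b) (p == b ∧ q == a)

  edge-sym : ∀ p q → edge a b p q ≡ edge a b q p
  edge-sym p q = trans (cong₂ _∨_ (∧-comm (p == a) (q == b)) (∧-comm (p == b) (q == a)))
                       (∨-comm (q == b ∧ p == a) (q == a ∧ p == b))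

  edge-endpoint : a ≢ b → ∀ q → edge a b a q ≡ (q == b)
  edge-endpoint a≢b q rewrite ==-refl a | ==-≢ a≢b = ∨-identityʳ (q == b)

  edge-away : ∀ {p} → p ≢ a → p ≢ b → ∀ q → edge a b p q ≡ false
  edge-away p≢a p≢b q rewrite ==-≢ p≢a | ==-≢ p≢b = refl

  edge-irrefl : a ≢ b → ∀ p → edge a b p p ≡ false
  edge-irrefl a≢b p with p == a in pa
  ... | false = ∧-zeroʳ (p == b)
  ... | true rewrite ==-≢ {i = p} {b} (λ p≡b → a≢b (trans (sym (==⇒≡ pa)) p≡b)) = refl

  edge-true : ∀ {p q} → edge a b p q ≡ true → (p ≡ a × q ≡ b) ⊎ (p ≡ b × q ≡ a)
  edge-true {p} {q} e with p == a in pa | q == b in qb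
  ... | true  | true  = inj₁ (==⇒≡ pa , ==⇒≡ qb)
  ... | true  | false = inj₂ (==⇒≡ (∧-conicalˡ _ _ e) , ==⇒≡ (∧-conicalʳ _ _ e))
  ... | false | _     = inj₂ (==⇒≡ (∧-conicalˡ _ _ e) , ==⇒≡ (∧-conicalʳ _ _ e))

  edge⇒adj≡ : (G : SimpleGraph n) → ∀ {p q} → edge a b p q ≡ true → adj G p q ≡ adj G a b
  edge⇒adj≡ G {p} {q} e with edge-true {p} {q} e
  ... | inj₁ (refl , refl) = refl
  ... | inj₂ (refl , refl) = SimpleGraph.sym G b a

record Switchable {n} (G : SimpleGraph n) (u v x y : Fin n) : Set where
  field
    uv∈G : adj G u v ≡ true
    xy∈G : adj G x y ≡ true
    ux∉G : adj G u x ≡ false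
    vy∉G : adj G v y ≡ false
    u≢x  : u ≢ x
    v≢y  : v ≢ y

module _ {n} (G : SimpleGraph n) (u v x y : Fin n) where

  switchAdj : Fin n → Fin n → Bool
  switchAdj p q = if edge u v p q ∨ edge x y p q then false
                  else if edge u x p q ∨ edge v y p q then true
                  else adj G p q

  switchAdj-sym : ∀ p q → switchAdj p q ≡ switchAdj q p
  switchAdj-sym p q rewrite edge-sym u v p q | edge-sym x y p q | edge-sym u x p q
                          | edge-sym v y p q | SimpleGraph.sym G p q = refl

  switchAdj-irrefl : u ≢ x → v ≢ y → ∀ p → switchAdj p p ≡ false
  switchAdj-irrefl u≢x v≢y p
    rewrite edge-irrefl u x u≢x p | edge-irrefl v y v≢y p | irrefl G p
    with edge u v p p ∨ edge x y p p
  ... | true  = refl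
  ... | false = refl

switch : ∀ {n} {G : SimpleGraph n} {u v x y} → Switchable G u v x y → SimpleGraph n
switch {G = G} {u} {v} {x} {y} s = record
  { adj    = switchAdj G u v x y
  ; sym    = switchAdj-sym G u v x y
  ; irrefl = switchAdj-irrefl G u v x y u≢x v≢y
  }
  where open Switchable s

module _ {n} {G : SimpleGraph n} {u v x y : Fin n} (s : Switchable G u v x y) where
  open Switchable s

  Switchable-flip : Switchable G v u y x
  Switchable-flip = record { uv∈G = trans (SimpleGraph.sym G v u) uv∈G ; xy∈G = trans (SimpleGraph.sym G y x) xy∈G
                ; ux∉G = vy∉G ; vy∉G = ux∉G ; u≢x = v≢y ; v≢y = u≢x }

  Switchable-swap : Switchable G x y u v
  Switchable-swap = record { uv∈G = xy∈G ; xy∈G = uv∈G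
                ; ux∉G = trans (SimpleGraph.sym G x u) ux∉G ; vy∉G = trans (SimpleGraph.sym G y v) vy∉G
                ; u≢x = u≢x ∘ sym ; v≢y = v≢y ∘ sym }

  switch-flip : ∀ p q → adj (switch Switchable-flip) p q ≡ adj (switch s) p q
  switch-flip p q rewrite edge-comm v u p q | edge-comm y x p q | ∨-comm (edge v y p q) (edge u x p q) = refl

  switch-swap : ∀ p q → adj (switch Switchable-swap) p q ≡ adj (switch s) p q
  switch-swap p q rewrite ∨-comm (edge x y p q) (edge u v p q) | edge-comm x u p q | edge-comm y v p q = refl

  u≢v : u ≢ v
  u≢v refl = contradiction (trans (sym uv∈G) (irrefl G u)) λ ()

  u≢y : u ≢ y
  u≢y refl = contradiction (trans (sym (trans (SimpleGraph.sym G v u) uv∈G)) vy∉G) λ ()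

  v≢x : v ≢ x
  v≢x refl = contradiction (trans (sym uv∈G) ux∉G) λ ()

  switch-row-first : ∀ q → adj (switch s) u q ≡ (if q == v then false else if q == x then true else adj G u q)
  switch-row-first q
    rewrite edge-endpoint u v u≢v q | edge-away x y u≢x u≢y q | edge-endpoint u x u≢x q
          | edge-away v y u≢v u≢y q | ∨-identityʳ (q == v) | ∨-identityʳ (q == x) = refl

  switch-deg-first : deg (switch s) u ≡ deg G u
  switch-deg-first = trans (countTrue-cong switch-row-first) (countTrue-move (adj G u) uv∈G ux∉G v≢x)

  switch-row-away : ∀ {p} → p ≢ u → p ≢ v → p ≢ x → p ≢ y → ∀ q → adj (switch s) p q ≡ adj G p q
  switch-row-away p≢u p≢v p≢x p≢y q
    rewrite edge-away u v p≢u p≢v q | edge-away x y p≢x p≢y q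
          | edge-away u x p≢u p≢x q | edge-away v y p≢v p≢y q = refl

-- The symmetries (u v x y) ↦ (v u y x) and (u v x y) ↦ (x y u v) of a switchable square preserve
-- the switch and act transitively on its corners, so the degree count is only needed at u.
switch-deg : ∀ {n} {G : SimpleGraph n} {u v x y} (s : Switchable G u v x y) → ∀ p → deg (switch s) p ≡ deg G p
switch-deg {G = G} {u} {v} {x} {y} s p = by-cases (p ≟ u) (p ≟ v) (p ≟ x) (p ≟ y)
  where
  by-cases : Dec (p ≡ u) → Dec (p ≡ v) → Dec (p ≡ x) → Dec (p ≡ y) → deg (switch s) p ≡ deg G p
  by-cases (yes refl) _ _ _ = switch-deg-first s
  by-cases (no _) (yes refl) _ _ =
    trans (countTrue-cong (sym ∘ switch-flip s p)) (switch-deg-first (Switchable-flip s))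
  by-cases (no _) (no _) (yes refl) _ =
    trans (countTrue-cong (sym ∘ switch-swap s p)) (switch-deg-first (Switchable-swap s))
  by-cases (no _) (no _) (no _) (yes refl) =
    trans (countTrue-cong (λ q → sym (trans (switch-flip (Switchable-swap s) p q) (switch-swap s p q))))
          (switch-deg-first (Switchable-flip (Switchable-swap s)))
  by-cases (no p≢u) (no p≢v) (no p≢x) (no p≢y) =
    countTrue-cong (switch-row-away s p≢u p≢v p≢x p≢y)

commonEdges : ∀ {n} → SimpleGraph n → SimpleGraph n → ℕ
commonEdges G H = pairCount (λ p q → adj G p q ∧ adj H p q)

module _ {n} {G H : SimpleGraph n} {u v x y : Fin n} (s : Switchable G u v x y)
         (uv∈H : adj H u v ≡ true) (ux∉H : adj H u x ≡ false) (vy∉H : adj H v y ≡ false) where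
  open Switchable s

  switch-common⊆common : ∀ p q → adj (switch s) p q ∧ adj H p q ≡ true → adj G p q ∧ adj H p q ≡ true
  switch-common⊆common p q e with edge u v p q ∨ edge x y p q | edge u x p q in pux | edge v y p q in pvy
  ... | false | true  | _     = contradiction (trans (sym (∧-conicalʳ _ _ e)) (trans (edge⇒adj≡ u x H pux) ux∉H)) λ ()
  ... | false | false | true  = contradiction (trans (sym (∧-conicalʳ _ _ e)) (trans (edge⇒adj≡ v y H pvy) vy∉H)) λ ()
  ... | false | false | false = e

  switch-commonEdges-< : commonEdges (switch s) H < commonEdges G H
  switch-commonEdges-< = pairCount-mono-< switch-common⊆common u v uv∉switch (cong₂ _∧_ uv∈G uv∈H)
    where
    uv∉switch : adj (switch s) u v ∧ adj H u v ≡ false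
    uv∉switch rewrite ==-refl u | ==-refl v = refl

closedNbhd : ∀ {n} → SimpleGraph n → SimpleGraph n → Fin n → Fin n → Bool
closedNbhd G H w z = if z == w then true else (adj G w z ∨ adj H w z)

module _ {n} (G H : SimpleGraph n) (w : Fin n) where

  closedNbhd-self : closedNbhd G H w w ≡ true
  closedNbhd-self rewrite ==-refl w = refl

  closedNbhd-adj : ∀ {z} → adj G w z ≡ true → closedNbhd G H w z ≡ true
  closedNbhd-adj {z} wz∈G with z == w
  ... | true  = refl
  ... | false rewrite wz∈G = refl

  ∉closedNbhd : ∀ {z} → closedNbhd G H w z ≡ false → z ≢ w × adj G w z ≡ false × adj H w z ≡ false
  ∉closedNbhd {z} z∉ with z == w in zw
  ... | false = (λ { refl → contradiction (trans (sym (==-refl w)) zw) λ () })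
              , ∨-conicalˡ _ _ z∉ , ∨-conicalʳ _ _ z∉

  closedNbhd-bound : ∀ {z} → adj G w z ≡ true → adj H w z ≡ true →
                     countTrue (closedNbhd G H w) ≤ deg G w + deg H w
  closedNbhd-bound {z} wz∈G wz∈H = begin
    countTrue (closedNbhd G H w) ≡⟨ countTrue-insert (λ z → adj G w z ∨ adj H w z)
                                                    (cong₂ _∨_ (irrefl G w) (irrefl H w)) ⟩
    suc U                        ≡⟨ +-comm 1 U ⟩
    U + 1                        ≤⟨ +-monoʳ-≤ U (countTrue-pos z (cong₂ _∧_ wz∈G wz∈H)) ⟩
    U + countTrue (λ z → adj G w z ∧ adj H w z) ≡⟨ countTrue-∨-∧ (adj G w) (adj H w) ⟩
    deg G w + deg H w            ∎
    where
    open ≤-Reasoning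
    U = countTrue (λ z → adj G w z ∨ adj H w z)

-- With a = 1 + a′ the bound reduces to a′ (2 + j) ≤ a′ (b + b), and 2 + j ≤ a + b ≤ b + b.
switch-counting-arith : ∀ {a b U T j} → 1 ≤ a → a ≤ b →
  U + (2 + j) ≤ (a + b) + (a + b) → 2 + j ≤ a + b → T ≤ j * a → U + T ≤ 2 * (a * b)
switch-counting-arith {suc a′} {b} {U} {T} {j} _ a≤b union inner outside =
  +-cancelʳ-≤ (2 + j) (U + T) (2 * (suc a′ * b)) (begin
    (U + T) + (2 + j)                           ≡⟨ reorder U T (2 + j) ⟩
    (U + (2 + j)) + T                           ≤⟨ +-mono-≤ union outside ⟩
    ((suc a′ + b) + (suc a′ + b)) + j * suc a′  ≡⟨ expand a′ b j ⟩
    (2 + (b + b) + a′ * (2 + j)) + j            ≤⟨ +-monoˡ-≤ j (+-monoʳ-≤ (2 + (b + b)) (*-monoʳ-≤ a′ 2+j≤b+b)) ⟩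
    (2 + (b + b) + a′ * (b + b)) + j            ≡⟨ collect a′ b j ⟩
    2 * (suc a′ * b) + (2 + j)                  ∎)
  where
  open ≤-Reasoning
  2+j≤b+b : 2 + j ≤ b + b
  2+j≤b+b = ≤-trans inner (+-monoˡ-≤ b a≤b)
  reorder : ∀ U T k → (U + T) + k ≡ (U + k) + T
  reorder = solve-∀
  expand : ∀ a′ b j → ((suc a′ + b) + (suc a′ + b)) + j * suc a′ ≡ (2 + (b + b) + a′ * (2 + j)) + j
  expand = solve-∀
  collect : ∀ a′ b j → (2 + (b + b) + a′ * (b + b)) + j ≡ 2 * (suc a′ * b) + (2 + j)
  collect = solve-∀

module _ {n a b} {G H : SimpleGraph n} (G≥1 : ∀ p → 1 ≤ deg G p) (G≤a : ∀ p → deg G p ≤ a)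
         (H≤b : ∀ p → deg H p ≤ b) (a≤b : a ≤ b) {u v : Fin n} (uv∈G : adj G u v ≡ true) (uv∈H : adj H u v ≡ true)
         (noSwitch : ∀ x y → adj G x y ≡ true →
                  closedNbhd G H u x ≡ false → closedNbhd G H v y ≡ false → ⊥) where

  private
    Nᵤ Nᵥ shared shared∖u inner outside : Fin n → Bool
    Nᵤ = closedNbhd G H u
    Nᵥ = closedNbhd G H v
    shared z = Nᵤ z ∧ Nᵥ z
    shared∖u z = if z == u then false else shared z
    inner z = if z == v then false else shared∖u z
    outside z = not (Nᵤ z ∨ Nᵥ z)

    vu∈G : adj G v u ≡ true
    vu∈G = trans (SimpleGraph.sym G v u) uv∈G

    v≢u : v ≢ u
    v≢u refl = contradiction (trans (sym uv∈G) (irrefl G u)) λ ()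

    shared-count : countTrue shared ≡ 2 + countTrue inner
    shared-count = begin
      countTrue shared
        ≡⟨ countTrue-delete shared (cong₂ _∧_ (closedNbhd-self G H u) (closedNbhd-adj G H v vu∈G)) ⟩
      suc (countTrue shared∖u)
        ≡⟨ cong suc (countTrue-delete shared∖u v∈shared∖u) ⟩
      2 + countTrue inner ∎
      where
      open ≡-Reasoning
      v∈shared∖u : shared∖u v ≡ true
      v∈shared∖u = trans (cong (if_then false else shared v) (==-≢ v≢u))
                         (cong₂ _∧_ (closedNbhd-adj G H u uv∈G) (closedNbhd-self G H v))

    outside-covered : ∀ x → outside x ≡ true → ∃ λ y → inner y ≡ true × adj G y x ≡ true
    outside-covered x out = y , y∈inner , yx∈G
      where
      x∉Nᵤ∪Nᵥ : Nᵤ x ∨ Nᵥ x ≡ false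
      x∉Nᵤ∪Nᵥ = trans (sym (not-involutive _)) (cong not out)
      x∉Nᵤ = ∨-conicalˡ _ _ x∉Nᵤ∪Nᵥ
      x∉Nᵥ = ∨-conicalʳ _ _ x∉Nᵤ∪Nᵥ
      neighbour = countTrue-witness (adj G x) (G≥1 x)
      y = proj₁ neighbour
      xy∈G = proj₂ neighbour
      yx∈G = trans (SimpleGraph.sym G y x) xy∈G
      y≢u : y ≢ u
      y≢u refl = contradiction (trans (sym yx∈G) (proj₁ (proj₂ (∉closedNbhd G H u x∉Nᵤ)))) λ ()
      y≢v : y ≢ v
      y≢v refl = contradiction (trans (sym yx∈G) (proj₁ (proj₂ (∉closedNbhd G H v x∉Nᵥ)))) λ ()
      y∈inner : inner y ≡ true
      y∈inner = trans (cong (if_then false else shared∖u y) (==-≢ y≢v))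
              $ trans (cong (if_then false else shared y) (==-≢ y≢u))
              $ cong₂ _∧_ (¬-not {y = false} λ y∉Nᵤ → noSwitch y x yx∈G y∉Nᵤ x∉Nᵥ)
                  (¬-not {y = false} λ y∉Nᵥ → noSwitch x y xy∈G x∉Nᵤ y∉Nᵥ)

  noSwitch⇒n≤2ab : n ≤ 2 * (a * b)
  noSwitch⇒n≤2ab = begin
    n                                                   ≡⟨ countTrue-not (λ z → Nᵤ z ∨ Nᵥ z) ⟨
    countTrue (λ z → Nᵤ z ∨ Nᵥ z) + countTrue outside   ≤⟨ switch-counting-arith 1≤a a≤b union inner≤ outside≤ ⟩
    2 * (a * b)                                         ∎
    where
    open ≤-Reasoning
    1≤a : 1 ≤ a
    1≤a = ≤-trans (G≥1 u) (G≤a u)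
    Nᵤ≤ : countTrue Nᵤ ≤ a + b
    Nᵤ≤ = ≤-trans (closedNbhd-bound G H u uv∈G uv∈H) (+-mono-≤ (G≤a u) (H≤b u))
    Nᵥ≤ : countTrue Nᵥ ≤ a + b
    Nᵥ≤ = ≤-trans (closedNbhd-bound G H v vu∈G (trans (SimpleGraph.sym H v u) uv∈H)) (+-mono-≤ (G≤a v) (H≤b v))
    union : countTrue (λ z → Nᵤ z ∨ Nᵥ z) + (2 + countTrue inner) ≤ (a + b) + (a + b)
    union = begin
      countTrue (λ z → Nᵤ z ∨ Nᵥ z) + (2 + countTrue inner) ≡⟨ cong (countTrue (λ z → Nᵤ z ∨ Nᵥ z) +_) shared-count ⟨
      countTrue (λ z → Nᵤ z ∨ Nᵥ z) + countTrue shared     ≡⟨ countTrue-∨-∧ Nᵤ Nᵥ ⟩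
      countTrue Nᵤ + countTrue Nᵥ                          ≤⟨ +-mono-≤ Nᵤ≤ Nᵥ≤ ⟩
      (a + b) + (a + b)                                    ∎
    inner≤ : 2 + countTrue inner ≤ a + b
    inner≤ = ≤-trans (≤-reflexive (sym shared-count)) (≤-trans (countTrue-mono {f = shared} {Nᵤ} (λ z → ∧-conicalˡ _ _)) Nᵤ≤)
    outside≤ : countTrue outside ≤ countTrue inner * a
    outside≤ = countTrue-cover outside inner (adj G) G≤a outside-covered

switch-exists : ∀ {n a b} {G H : SimpleGraph n} →
  (∀ p → 1 ≤ deg G p) → (∀ p → deg G p ≤ a) → (∀ p → deg H p ≤ b) → a ≤ b → 2 * (a * b) < n →
  ∀ {u v} → adj G u v ≡ true → adj H u v ≡ true →
  ∃₂ λ x y → Switchable G u v x y × adj H u x ≡ false × adj H v y ≡ false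
switch-exists {G = G} {H} G≥1 G≤a H≤b a≤b 2ab<n {u} {v} uv∈G uv∈H
  with any? (λ x → any? λ y →
         (adj G x y ≟ᵇ true) ×-dec (closedNbhd G H u x ≟ᵇ false) ×-dec (closedNbhd G H v y ≟ᵇ false))
... | no none = contradiction
  (noSwitch⇒n≤2ab {G = G} {H} G≥1 G≤a H≤b a≤b uv∈G uv∈H λ x y xy∈G x∉Nᵤ y∉Nᵥ → none (x , y , xy∈G , x∉Nᵤ , y∉Nᵥ))
  (<⇒≱ 2ab<n)
... | yes (x , y , xy∈G , x∉Nᵤ , y∉Nᵥ) with ∉closedNbhd G H u x∉Nᵤ | ∉closedNbhd G H v y∉Nᵥ
...   | x≢u , ux∉G , ux∉H | y≢v , vy∉G , vy∉H = x , y , s , ux∉H , vy∉H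
  where
  s : Switchable G u v x y
  s = record { uv∈G = uv∈G ; xy∈G = xy∈G ; ux∉G = ux∉G ; vy∉G = vy∉G ; u≢x = x≢u ∘ sym ; v≢y = y≢v ∘ sym }

Pack-sym : ∀ {n} {d₁ d₂ : Vector ℕ n} → Pack d₂ d₁ → Pack d₁ d₂
Pack-sym (G₂ , G₁ , disjoint , r₂ , r₁) = G₁ , G₂ , (λ i j (e₁ , e₂) → disjoint i j (e₂ , e₁)) , r₁ , r₂

module _ {n a b} {d₁ d₂ : Vector ℕ n} (d₁≥1 : ∀ i → 1 ≤ d₁ i) (d₁≤a : ∀ i → d₁ i ≤ a)
         (d₂≤b : ∀ i → d₂ i ≤ b) (a≤b : a ≤ b) (2ab<n : 2 * (a * b) < n) where

  pack-fuel : ∀ m (G₁ G₂ : SimpleGraph n) → Realizes G₁ d₁ → Realizes G₂ d₂ →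
              commonEdges G₁ G₂ < m → Pack d₁ d₂
  pack-fuel (suc m) G₁ G₂ r₁ r₂ c<m
    with any? (λ u → any? λ v → (adj G₁ u v ≟ᵇ true) ×-dec (adj G₂ u v ≟ᵇ true))
  ... | no disjoint = G₁ , G₂ , (λ u v uv∈both → disjoint (u , v , uv∈both)) , r₁ , r₂
  ... | yes (u , v , uv∈G₁ , uv∈G₂)
    with switch-exists {G = G₁} {G₂}
           (λ p → subst (1 ≤_) (sym (r₁ p)) (d₁≥1 p)) (λ p → subst (_≤ a) (sym (r₁ p)) (d₁≤a p))
           (λ p → subst (_≤ b) (sym (r₂ p)) (d₂≤b p)) a≤b 2ab<n uv∈G₁ uv∈G₂
  ...   | x , y , s , ux∉G₂ , vy∉G₂ =
    pack-fuel m (switch s) G₂ (λ p → trans (switch-deg s p) (r₁ p)) r₂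
              (<-≤-trans (switch-commonEdges-< {H = G₂} s uv∈G₂ ux∉G₂ vy∉G₂) (s≤s⁻¹ c<m))

  pack : ∀ G₁ G₂ → Realizes G₁ d₁ → Realizes G₂ d₂ → Pack d₁ d₂
  pack G₁ G₂ r₁ r₂ = pack-fuel (suc (commonEdges G₁ G₂)) G₁ G₂ r₁ r₂ ≤-refl

module _ {k} {d : Vector ℕ (suc k)} (decreasing : WeaklyDecreasing d) where

  WeaklyDecreasing⇒≤head : ∀ i → d i ≤ d zero
  WeaklyDecreasing⇒≤head i = decreasing zero i z≤n

  WeaklyDecreasing⇒last≤ : ∀ i → d (fromℕ k) ≤ d i
  WeaklyDecreasing⇒last≤ i = decreasing i (fromℕ k) (≤fromℕ i)

theorem8 : (k : ℕ) → 3 ≤ suc k → (d₁ d₂ : Vector ℕ (suc k)) →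
    Graphic d₁ → Graphic d₂ →
    1 ≤ d₁ (fromℕ k) → 1 ≤ d₂ (fromℕ k) →
    2 * (d₁ zero * d₂ zero) < suc k →
    Pack d₁ d₂
theorem8 k _ d₁ d₂ (dec₁ , G₁ , r₁) (dec₂ , G₂ , r₂) last₁≥1 last₂≥1 2ab<n
  with d₁ zero ≤? d₂ zero
... | yes a≤b = pack (λ i → ≤-trans last₁≥1 (WeaklyDecreasing⇒last≤ dec₁ i))
                     (WeaklyDecreasing⇒≤head dec₁) (WeaklyDecreasing⇒≤head dec₂) a≤b 2ab<n G₁ G₂ r₁ r₂
... | no a≰b = Pack-sym (pack (λ i → ≤-trans last₂≥1 (WeaklyDecreasing⇒last≤ dec₂ i))
                              (WeaklyDecreasing⇒≤head dec₂) (WeaklyDecreasing⇒≤head dec₁) (<⇒≤ (≰⇒> a≰b))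
                              (subst (λ m → 2 * m < suc k) (*-comm (d₁ zero) (d₂ zero)) 2ab<n) G₂ G₁ r₂ r₁)
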